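{- Let $k \geq 4$ be an integer and let $H$ be a finite simple bipartite graph. Let $H'$ be any graph obtained from $H$ as follows: for each vertex $v \in V(H)$ there is a nonempty set (bag) $B_v$ of vertices of $H'$, the bags being pairwise disjoint with union $V(H')$, such that (a) for every $x \in B_u$ and $y \in B_v$ (with $u \neq v$), $(x,y) \in E(H')$ if and only if $(u,v) \in E(H)$, and (b) the vertices within each bag are pairwise non-adjacent in $H'$. If $H$ is $k$-chordal, then $H'$ is $k$-chordal.
   Context: A hole in a graph is an induced (chordless) cycle. A graph is $k$-chordal if it has no hole with more than $k$ vertices. -}

module Defs where

open import Data.Nat using (ℕ; zero; suc; _≤_)
open import Data.Fin using (Fin; toℕ)
open import Data.Bool using (Bool)
open import Data.Product using (_×_; Σ)
open import Data.Sum using (_⊎_)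
open import Relation.Nullary using (¬_; Dec)
open import Relation.Binary.PropositionalEquality using (_≡_; _≢_)
open import Function.Bundles using (_⇔_)
open import Function.Definitions using (Injective; Surjective)

record Graph (n : ℕ) : Set₁ where
  field
    Adj     : Fin n → Fin n → Set
    adj?    : ∀ u v → Dec (Adj u v)
    symm    : ∀ {u v} → Adj u v → Adj v u
    irrefl  : ∀ {u} → ¬ Adj u u
open Graph public

Bipartite : ∀ {n} → Graph n → Set
Bipartite {n} G = Σ (Fin n → Bool) (λ c → ∀ {u v : Fin n} → Adj G u v → c u ≢ c v)

CycAdj : ∀ {m} → Fin m → Fin m → Set
CycAdj {m} i j =
  (suc (toℕ i) ≡ toℕ j) ⊎ (suc (toℕ j) ≡ toℕ i)
  ⊎ (toℕ i ≡ 0 × suc (toℕ j) ≡ m) ⊎ (toℕ j ≡ 0 × suc (toℕ i) ≡ m)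

-- A hole (induced / chordless cycle) with m ≥ 3 vertices, listed as f 0, ..., f (m-1):
-- f is injective and f i, f j are adjacent exactly when i, j are consecutive on the cycle.
IsHole : ∀ {n} → Graph n → (m : ℕ) → (Fin m → Fin n) → Set
IsHole G m f =
  3 ≤ m × Injective _≡_ _≡_ f × (∀ i j → Adj G (f i) (f j) ⇔ CycAdj i j)

KChordal : ℕ → ∀ {n} → Graph n → Set
KChordal k G = ∀ m f → IsHole G m f → m ≤ k

-- H' is obtained from H by replacing each vertex v by a nonempty independent bag
-- B_v = β⁻¹(v) (β surjective; bags partition V(H')), with complete/anticomplete
-- connections between distinct bags according to E(H).
IsBlowup : ∀ {n n'} → Graph n → Graph n' → (Fin n' → Fin n) → Set
IsBlowup H H' β =
  Surjective _≡_ _≡_ β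
  × (∀ x y → β x ≢ β y → (Adj H' x y ⇔ Adj H (β x) (β y)))
  × (∀ x y → β x ≡ β y → ¬ Adj H' x y)

-- In a blow-up, two vertices of the same bag are twins: they are non-adjacent and
-- have the same neighbours outside their bag. On a hole of length at least 5 no
-- two distinct vertices have the same neighbours, so the vertices of such a hole
-- lie in pairwise distinct bags, and mapping each to its bag gives a hole of the
-- same length in H. Holes of length at most 4 are harmless since k ≥ 4.
module Submission where

open import Defs
open import Data.Nat using (ℕ; zero; suc; _≤_; _<_; _+_; s≤s; z≤n; _≟_; _≤?_)
open import Data.Nat.Properties using (≤-refl; ≤-trans; n≤1+n; ≤∧≢⇒<; <-irrefl; ≰⇒>; suc-injective)
open import Data.Fin using (Fin; toℕ; fromℕ<)
open import Data.Fin.Properties using (toℕ-fromℕ<; toℕ-injective; toℕ<n)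
open import Data.Product using (_×_; _,_; proj₁; proj₂)
open import Data.Sum using (_⊎_; inj₁; inj₂)
open import Data.Empty using (⊥-elim)
open import Relation.Nullary using (yes; no)
open import Relation.Binary.PropositionalEquality using (_≡_; _≢_; refl; sym; trans; subst)
open import Function.Bundles using (_⇔_; mk⇔; Equivalence)
open Equivalence using (to; from)
open import Function.Properties.Equivalence using () renaming (sym to ⇔-sym; trans to ⇔-trans)
open import Function.Definitions using (Injective)

-- CycAdj read on positions in ℕ: CycAdj i j is definitionally CycNbr m (toℕ i) (toℕ j).
CycNbr : ℕ → ℕ → ℕ → Set
CycNbr m a c = (suc a ≡ c) ⊎ (suc c ≡ a) ⊎ (a ≡ 0 × suc c ≡ m) ⊎ (c ≡ 0 × suc a ≡ m)

-- Only the two neighbours of a are used: for m ≥ 5, a is the sole position adjacent to both.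
cycNbr-twins : ∀ {m a b} → 5 ≤ m → a < m → (∀ c → c < m → CycNbr m a c → CycNbr m b c) → a ≡ b
cycNbr-twins {a = zero} (s≤s (s≤s (s≤s (s≤s (s≤s {n = m'} _))))) _ nbr =
  first (nbr 1 (s≤s (s≤s z≤n)) (inj₁ refl)) (nbr (4 + m') ≤-refl (inj₂ (inj₂ (inj₁ (refl , refl)))))
  where
  first : ∀ {b} → CycNbr (5 + m') b 1 → CycNbr (5 + m') b (4 + m') → 0 ≡ b
  first (inj₁ refl) _ = refl
  first (inj₂ (inj₁ refl)) (inj₁ ())
  first (inj₂ (inj₁ refl)) (inj₂ (inj₁ ()))
  first (inj₂ (inj₁ refl)) (inj₂ (inj₂ (inj₁ (() , _))))
  first (inj₂ (inj₁ refl)) (inj₂ (inj₂ (inj₂ (() , _))))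
  first (inj₂ (inj₂ (inj₁ (refl , ())))) _
  first (inj₂ (inj₂ (inj₂ (() , _)))) _
cycNbr-twins {a = suc a} (s≤s (s≤s (s≤s (s≤s (s≤s {n = m'} _))))) a<m nbr with suc (suc a) ≟ 5 + m'
... | yes isLast =
  last isLast (nbr 0 (s≤s z≤n) (inj₂ (inj₂ (inj₂ (refl , isLast))))) (nbr a (≤-trans (n≤1+n _) a<m) (inj₂ (inj₁ refl)))
  where
  last : ∀ {b} → suc (suc a) ≡ 5 + m' → CycNbr (5 + m') b 0 → CycNbr (5 + m') b a → suc a ≡ b
  last _ (inj₁ ()) _
  last isLast (inj₂ (inj₁ refl)) (inj₁ refl) with isLast
  ... | ()
  last isLast (inj₂ (inj₁ refl)) (inj₂ (inj₁ refl)) with isLast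
  ... | ()
  last _ (inj₂ (inj₁ refl)) (inj₂ (inj₂ (inj₁ (() , _))))
  last _ (inj₂ (inj₁ refl)) (inj₂ (inj₂ (inj₂ (refl , ()))))
  last _ (inj₂ (inj₂ (inj₁ (refl , ())))) _
  last isLast (inj₂ (inj₂ (inj₂ (refl , b+1≡m)))) _ = suc-injective (trans isLast (sym b+1≡m))
... | no notLast =
  middle (nbr (suc (suc a)) (≤∧≢⇒< a<m notLast) (inj₁ refl)) (nbr a (≤-trans (n≤1+n _) a<m) (inj₂ (inj₁ refl)))
  where
  middle : ∀ {b} → CycNbr (5 + m') b (suc (suc a)) → CycNbr (5 + m') b a → suc a ≡ b
  middle (inj₁ refl) _ = refl
  middle (inj₂ (inj₁ refl)) (inj₁ ())
  middle (inj₂ (inj₁ refl)) (inj₂ (inj₁ ()))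
  middle (inj₂ (inj₁ refl)) (inj₂ (inj₂ (inj₁ (() , _))))
  middle (inj₂ (inj₁ refl)) (inj₂ (inj₂ (inj₂ (refl , ()))))
  middle (inj₂ (inj₂ (inj₁ (refl , a+3≡m)))) (inj₁ refl) with a+3≡m
  ... | ()
  middle (inj₂ (inj₂ (inj₁ (refl , _)))) (inj₂ (inj₁ ()))
  middle (inj₂ (inj₂ (inj₁ (refl , _)))) (inj₂ (inj₂ (inj₁ (refl , 1≡m)))) = ⊥-elim (<-irrefl 1≡m a<m)
  middle (inj₂ (inj₂ (inj₁ (refl , _)))) (inj₂ (inj₂ (inj₂ (refl , ()))))
  middle (inj₂ (inj₂ (inj₂ (() , _)))) _

cycAdj-twins : ∀ {m} → 5 ≤ m → (i j : Fin m) → (∀ l → CycAdj i l → CycAdj j l) → i ≡ j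
cycAdj-twins {m} 5≤m i j nbr = toℕ-injective (cycNbr-twins 5≤m (toℕ<n i) nbrℕ)
  where
  nbrℕ : ∀ c → c < m → CycNbr m (toℕ i) c → CycNbr m (toℕ j) c
  nbrℕ c c<m adj = subst (CycNbr m (toℕ j)) (toℕ-fromℕ< c<m)
    (nbr (fromℕ< c<m) (subst (CycNbr m (toℕ i)) (sym (toℕ-fromℕ< c<m)) adj))

module _ {n n'} {H : Graph n} {H' : Graph n'} {β : Fin n' → Fin n} (blowup : IsBlowup H H' β) where

  blowup-adj⇒bag≢ : ∀ {x y} → Adj H' x y → β x ≢ β y
  blowup-adj⇒bag≢ {x} {y} adj same = proj₂ (proj₂ blowup) x y same adj

  -- Also holds inside a bag, where both sides are empty.
  blowup-adj⇔ : ∀ x y → Adj H' x y ⇔ Adj H (β x) (β y)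
  blowup-adj⇔ x y = mk⇔
    (λ adj → to (across (blowup-adj⇒bag≢ adj)) adj)
    (λ adj → from (across (λ same → irrefl H (subst (Adj H (β x)) (sym same) adj))) adj)
    where
    across : β x ≢ β y → Adj H' x y ⇔ Adj H (β x) (β y)
    across = proj₁ (proj₂ blowup) x y

  blowup-twins : ∀ {x y z} → β x ≡ β y → Adj H' x z → Adj H' y z
  blowup-twins {x} {y} {z} same adj =
    from (blowup-adj⇔ y z) (subst (λ u → Adj H u (β z)) same (to (blowup-adj⇔ x z) adj))

  module _ {m} {f : Fin m → Fin n'} (hole : IsHole H' m f) where

    private
      hole-adj⇔ : ∀ i j → Adj H' (f i) (f j) ⇔ CycAdj i j
      hole-adj⇔ = proj₂ (proj₂ hole)

    blowup-hole-bags-injective : 5 ≤ m → Injective _≡_ _≡_ (λ i → β (f i))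
    blowup-hole-bags-injective 5≤m {i} {j} same = cycAdj-twins 5≤m i j λ l i~l →
      to (hole-adj⇔ j l) (blowup-twins same (from (hole-adj⇔ i l) i~l))

    blowup-hole-projects : 5 ≤ m → IsHole H m (λ i → β (f i))
    blowup-hole-projects 5≤m = proj₁ hole , blowup-hole-bags-injective 5≤m ,
      λ i j → ⇔-trans (⇔-sym (blowup-adj⇔ (f i) (f j))) (hole-adj⇔ i j)

mainTheorem2 : (k : ℕ) → 4 ≤ k → {n n' : ℕ} (H : Graph n) (H' : Graph n')
    → Bipartite H → (β : Fin n' → Fin n) → IsBlowup H H' β
    → KChordal k H → KChordal k H'
mainTheorem2 k 4≤k H H' _ β blowup chordal m f hole with m ≤? 4
... | yes m≤4 = ≤-trans m≤4 4≤k
... | no m≰4 = chordal m (λ i → β (f i)) (blowup-hole-projects {H = H} {H' = H'} blowup hole (≰⇒> m≰4))
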